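{- Let $(G,S,T,B,C,D)$ be an $(s,t)$-signed-graft and let $S'$ be a one-element set disjoint from $V(G)$. The cogirth of $M(G,S,T,B,C,D)/T$ is the minimum of the cogirths of the matroids $M(G,S',T,B,yC,yD)/T$ taken over all vectors $y\in\mathrm{GF}(2)^{S'\times S}$.
   Context: An $(s,t)$-signed-graft is a tuple $(G,S,T,B,C,D)$ where $G$ is a graph, $S$ is an $s$-element set disjoint from $V(G)$, $T$ is a $t$-element set disjoint from $E(G)$, $B\in\mathrm{GF}(2)^{V(G)\times T}$, $C\in\mathrm{GF}(2)^{S\times E(G)}$, $D\in\mathrm{GF}(2)^{S\times T}$. Its incidence matrix has rows $S\cup V(G)$, columns $E(G)\cup T$, and equals $\begin{pmatrix} C & D\\ A(G) & B\end{pmatrix}$ where $A(G)$ is the $\mathrm{GF}(2)$ incidence matrix of $G$; $M(G,S,T,B,C,D)$ is the binary matroid represented by it and $/T$ denotes contraction. A cocycle of a binary matroid is a disjoint union of cocircuits (for a represented matroid $M(A)$: the support of a vector in the row space of $A$); the cogirth is the size of a smallest non-empty cocycle ($\infty$ if none). -}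

module Defs where

open import Data.Bool using (Bool; true; false; _xor_; _∧_; _∨_; not; if_then_else_)
open import Data.Nat using (ℕ; zero; suc; _+_; _⊓_)
open import Data.Fin using (Fin; zero; suc; _↑ˡ_; _↑ʳ_; splitAt)
open import Data.Sum using (_⊎_; inj₁; inj₂)
open import Data.Product using (_×_; _,_; proj₁; proj₂)
open import Data.Maybe using (Maybe; just; nothing)
open import Data.List using (List; []; _∷_; map; concatMap; foldr)
open import Data.Vec.Functional using (Vector) renaming (_∷_ to _∷ᶠ_)

-- GF(2) is modelled by Bool: addition = _xor_, multiplication = _∧_.
-- A matrix over GF(2) with rows indexed by Fin r and columns by Fin c.
Mat : ℕ → ℕ → Set
Mat r c = Fin r → Fin c → Bool

Σ₂ : {r : ℕ} → (Fin r → Bool) → Bool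
Σ₂ {zero}  f = false
Σ₂ {suc r} f = f zero xor Σ₂ (λ i → f (suc i))

count : {r : ℕ} → (Fin r → Bool) → ℕ
count {zero}  f = 0
count {suc r} f = (if f zero then 1 else 0) + count (λ i → f (suc i))

anyTrue : {r : ℕ} → (Fin r → Bool) → Bool
anyTrue {zero}  f = false
anyTrue {suc r} f = f zero ∨ anyTrue (λ i → f (suc i))

_⊗_ : {a b c : ℕ} → Mat a b → Mat b c → Mat a c
(X ⊗ Y) i k = Σ₂ (λ j → X i j ∧ Y j k)

record Graph (n m : ℕ) : Set where
  field
    ends : Fin m → Fin n × Fin n

eqFin : {n : ℕ} → Fin n → Fin n → Bool
eqFin zero    zero    = true
eqFin zero    (suc _) = false
eqFin (suc _) zero    = false
eqFin (suc i) (suc j) = eqFin i j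

-- GF(2) incidence matrix A(G): entry (v,e) is 1 iff v is an end of the
-- non-loop edge e (a loop gives a zero column, as over GF(2) 1+1=0).
incidence : {n m : ℕ} → Graph n m → Mat n m
incidence G v e = eqFin v (proj₁ (Graph.ends G e)) xor eqFin v (proj₂ (Graph.ends G e))

-- Incidence matrix of the (s,t)-signed-graft (G,S,T,B,C,D) with S = Fin s,
-- T = Fin t: rows S ⊎ V(G) encoded as Fin (s + n), columns E(G) ⊎ T
-- encoded as Fin (m + t); block form  ( C D ; A(G) B ).
graftMatrix : {n m s t : ℕ} → Graph n m → Mat n t → Mat s m → Mat s t → Mat (s + n) (m + t)
graftMatrix {n} {m} {s} {t} G B C D i j with splitAt s i | splitAt m j
... | inj₁ a | inj₁ e = C a e
... | inj₁ a | inj₂ τ = D a τ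
... | inj₂ v | inj₁ e = incidence G v e
... | inj₂ v | inj₂ τ = B v τ

allVecs : (r : ℕ) → List (Fin r → Bool)
allVecs zero    = (λ ()) ∷ []
allVecs (suc r) = concatMap (λ v → (false ∷ᶠ v) ∷ (true ∷ᶠ v) ∷ []) (allVecs r)

rowComb : {r c : ℕ} → Mat r c → (Fin r → Bool) → Fin c → Bool
rowComb A x j = Σ₂ (λ i → x i ∧ A i j)

-- minimum in ℕ ∪ {∞}, with nothing = ∞
minᵢ : Maybe ℕ → Maybe ℕ → Maybe ℕ
minᵢ nothing  b        = b
minᵢ (just a) nothing  = just a
minᵢ (just a) (just b) = just (a ⊓ b)

minList : List (Maybe ℕ) → Maybe ℕ
minList = foldr minᵢ nothing

-- Cocycles of M(A)/T, where A has columns E ⊎ T (E = first m, T = last t):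
-- the cocycle space of a contraction M/T consists of the cocycles of M
-- disjoint from T, i.e. supports of row-space vectors of A vanishing on T
-- (these supports lie in E).
cocycleSize : {r m t : ℕ} → Mat r (m + t) → (Fin r → Bool) → Maybe ℕ
cocycleSize {r} {m} {t} A x =
  let w = rowComb A x in
  if anyTrue (λ τ → w (m ↑ʳ τ)) then nothing
  else (if anyTrue (λ e → w (e ↑ˡ t)) then just (count (λ e → w (e ↑ˡ t))) else nothing)

cogirth/T : {r : ℕ} (m t : ℕ) → Mat r (m + t) → Maybe ℕ
cogirth/T {r} m t A = minList (map (cocycleSize {r} {m} {t} A) (allVecs r))

minOverY : {s : ℕ} → (Mat 1 s → Maybe ℕ) → Maybe ℕ
minOverY {s} f = minList (map (λ y → f (λ _ → y)) (allVecs s))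

{-# OPTIONS --safe #-}
-- A row-space vector of the graft matrix is x_S^T (C D) + x_V^T (A(G) B).  With
-- y = x_S it is also the row-space vector 1·(yC yD) + x_V^T (A(G) B) of the graft
-- with the single signed row (yC yD); conversely the row-space vector
-- a·(yC yD) + x_V^T (A(G) B) of that graft arises from x_S = a·y.  So the cocycle
-- sizes minimised on the left are exactly those minimised on the right.
module Submission where

open import Defs
open import Data.Bool using (Bool; true; false; _xor_; _∧_; _∨_; if_then_else_)
open import Data.Bool.Properties using (xor-assoc; ∧-distribˡ-xor; ∧-assoc)
open import Data.Fin using (zero; suc; _↑ˡ_; _↑ʳ_; splitAt)
open import Data.Fin.Properties using (splitAt-↑ˡ; splitAt-↑ʳ)
open import Data.List using ([]; _∷_; map)
open import Data.List.Membership.Propositional using (_∈_)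
open import Data.List.Membership.Propositional.Properties using (∈-concatMap⁺)
open import Data.List.Relation.Unary.Any as Any using (here; there)
open import Data.Maybe using (Maybe; just; nothing)
open import Data.Nat using (ℕ; zero; suc; _+_; _≤_)
open import Data.Nat.Properties using (≤-refl; ≤-trans; ≤-antisym; m⊓n≤m; m⊓n≤n; ⊓-glb)
open import Data.Product using (∃; _×_; _,_)
open import Data.Sum using (inj₁; inj₂; [_,_])
open import Data.Vec.Functional using (Vector; tail; _++_) renaming (_∷_ to _∷ᶠ_)
open import Data.Vec.Functional.Properties using (lookup-++ˡ; lookup-++ʳ)
open import Relation.Binary.PropositionalEquality
  using (_≡_; refl; sym; trans; cong; cong₂; _≗_; module ≡-Reasoning)

infix 4 _≤∞_

data _≤∞_ : Maybe ℕ → Maybe ℕ → Set where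
  ≤∞-nothing : ∀ {a} → a ≤∞ nothing
  ≤∞-just    : ∀ {a b} → a ≤ b → just a ≤∞ just b

≤∞-refl : ∀ a → a ≤∞ a
≤∞-refl nothing  = ≤∞-nothing
≤∞-refl (just a) = ≤∞-just ≤-refl

≤∞-reflexive : ∀ {a b} → a ≡ b → a ≤∞ b
≤∞-reflexive {a} refl = ≤∞-refl a

≤∞-trans : ∀ {a b c} → a ≤∞ b → b ≤∞ c → a ≤∞ c
≤∞-trans _             ≤∞-nothing    = ≤∞-nothing
≤∞-trans (≤∞-just a≤b) (≤∞-just b≤c) = ≤∞-just (≤-trans a≤b b≤c)

≤∞-antisym : ∀ {a b} → a ≤∞ b → b ≤∞ a → a ≡ b
≤∞-antisym ≤∞-nothing    ≤∞-nothing    = refl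
≤∞-antisym (≤∞-just a≤b) (≤∞-just b≤a) = cong just (≤-antisym a≤b b≤a)

minᵢ-≤ˡ : ∀ a b → minᵢ a b ≤∞ a
minᵢ-≤ˡ nothing  b        = ≤∞-nothing
minᵢ-≤ˡ (just a) nothing  = ≤∞-refl (just a)
minᵢ-≤ˡ (just a) (just b) = ≤∞-just (m⊓n≤m a b)

minᵢ-≤ʳ : ∀ a b → minᵢ a b ≤∞ b
minᵢ-≤ʳ a        nothing  = ≤∞-nothing
minᵢ-≤ʳ nothing  (just b) = ≤∞-refl (just b)
minᵢ-≤ʳ (just a) (just b) = ≤∞-just (m⊓n≤n a b)

minᵢ-glb : ∀ {c a b} → c ≤∞ a → c ≤∞ b → c ≤∞ minᵢ a b
minᵢ-glb {a = nothing}              _             c≤b           = c≤b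
minᵢ-glb {a = just a} {b = nothing} c≤a           _             = c≤a
minᵢ-glb {a = just a} {b = just b}  (≤∞-just c≤a) (≤∞-just c≤b) = ≤∞-just (⊓-glb c≤a c≤b)

module _ {A : Set} (f : A → Maybe ℕ) where

  minList-≤ : ∀ {L x} → x ∈ L → minList (map f L) ≤∞ f x
  minList-≤ {y ∷ L} (here refl) = minᵢ-≤ˡ (f y) (minList (map f L))
  minList-≤ {y ∷ L} (there x∈L) = ≤∞-trans (minᵢ-≤ʳ (f y) (minList (map f L))) (minList-≤ x∈L)

  minList-glb : ∀ {c} L → (∀ {x} → x ∈ L → c ≤∞ f x) → c ≤∞ minList (map f L)
  minList-glb []      _   = ≤∞-nothing
  minList-glb (y ∷ L) c≤f = minᵢ-glb (c≤f (here refl)) (minList-glb L (λ x∈L → c≤f (there x∈L)))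

∷ᶠ-∈-allVecs-step : ∀ {r} b (w : Vector Bool r) → (b ∷ᶠ w) ∈ (false ∷ᶠ w) ∷ (true ∷ᶠ w) ∷ []
∷ᶠ-∈-allVecs-step false w = here refl
∷ᶠ-∈-allVecs-step true  w = there (here refl)

allVecs-complete : ∀ r (v : Vector Bool r) → ∃ λ w → w ∈ allVecs r × w ≗ v
allVecs-complete zero    v = (λ ()) , here refl , λ ()
allVecs-complete (suc r) v with allVecs-complete r (tail v)
... | w , w∈ , w≗ = v zero ∷ᶠ w , member , pointwise
  where
  member : (v zero ∷ᶠ w) ∈ allVecs (suc r)
  member = ∈-concatMap⁺ _ (Any.map (λ { refl → ∷ᶠ-∈-allVecs-step (v zero) w }) w∈)

  pointwise : (v zero ∷ᶠ w) ≗ v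
  pointwise zero    = refl
  pointwise (suc i) = w≗ i

minList-allVecs-≤ : ∀ {r} (f : Vector Bool r → Maybe ℕ) → (∀ {v w} → v ≗ w → f v ≡ f w) →
                    ∀ v → minList (map f (allVecs r)) ≤∞ f v
minList-allVecs-≤ {r} f f-cong v with allVecs-complete r v
... | w , w∈ , w≗v = ≤∞-trans (minList-≤ f w∈) (≤∞-reflexive (f-cong w≗v))

Σ₂-cong : ∀ {r} {f g : Vector Bool r} → f ≗ g → Σ₂ f ≡ Σ₂ g
Σ₂-cong {zero}  f≗g = refl
Σ₂-cong {suc r} f≗g = cong₂ _xor_ (f≗g zero) (Σ₂-cong (λ i → f≗g (suc i)))

Σ₂-split : ∀ s {n} (f : Vector Bool (s + n)) → Σ₂ f ≡ Σ₂ (λ k → f (k ↑ˡ n)) xor Σ₂ (λ i → f (s ↑ʳ i))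
Σ₂-split zero    f = refl
Σ₂-split (suc s) f =
  trans (cong (f zero xor_) (Σ₂-split s (tail f))) (sym (xor-assoc (f zero) _ _))

∧-distribˡ-Σ₂ : ∀ {r} a (f : Vector Bool r) → a ∧ Σ₂ f ≡ Σ₂ (λ k → a ∧ f k)
∧-distribˡ-Σ₂ {zero}  false f = refl
∧-distribˡ-Σ₂ {zero}  true  f = refl
∧-distribˡ-Σ₂ {suc r} a     f =
  trans (∧-distribˡ-xor a (f zero) _) (cong (a ∧ f zero xor_) (∧-distribˡ-Σ₂ a (tail f)))

anyTrue-cong : ∀ {r} {f g : Vector Bool r} → f ≗ g → anyTrue f ≡ anyTrue g
anyTrue-cong {zero}  f≗g = refl
anyTrue-cong {suc r} f≗g = cong₂ _∨_ (f≗g zero) (anyTrue-cong (λ i → f≗g (suc i)))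

count-cong : ∀ {r} {f g : Vector Bool r} → f ≗ g → count f ≡ count g
count-cong {zero}  f≗g = refl
count-cong {suc r} f≗g =
  cong₂ _+_ (cong (λ b → if b then 1 else 0) (f≗g zero)) (count-cong (λ i → f≗g (suc i)))

module _ {c : ℕ} where

  rowComb-congʳ : ∀ {r} (A : Mat r c) {x x′} → x ≗ x′ → rowComb A x ≗ rowComb A x′
  rowComb-congʳ A x≗x′ j = Σ₂-cong (λ i → cong (_∧ A i j) (x≗x′ i))

  rowComb-split : ∀ s {n} (A : Mat (s + n) c) x j →
    rowComb A x j ≡ rowComb (λ k → A (k ↑ˡ n)) (λ k → x (k ↑ˡ n)) j
                    xor rowComb (λ i → A (s ↑ʳ i)) (λ i → x (s ↑ʳ i)) j
  rowComb-split s A x j = Σ₂-split s (λ i → x i ∧ A i j)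

  rowComb-scale : ∀ {r} (A : Mat r c) a y j → rowComb A (λ k → a ∧ y k) j ≡ a ∧ rowComb A y j
  rowComb-scale A a y j =
    trans (Σ₂-cong (λ k → ∧-assoc a (y k) (A k j))) (sym (∧-distribˡ-Σ₂ a (λ k → y k ∧ A k j)))

cocycleSizeOf : ∀ m t → Vector Bool (m + t) → Maybe ℕ
cocycleSizeOf m t w =
  if anyTrue (λ τ → w (m ↑ʳ τ)) then nothing
  else (if anyTrue (λ e → w (e ↑ˡ t)) then just (count (λ e → w (e ↑ˡ t))) else nothing)

cocycleSizeOf-cong : ∀ m t {w w′} → w ≗ w′ → cocycleSizeOf m t w ≡ cocycleSizeOf m t w′
cocycleSizeOf-cong m t w≗w′
  rewrite anyTrue-cong (λ τ → w≗w′ (m ↑ʳ τ))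
        | anyTrue-cong (λ e → w≗w′ (e ↑ˡ t))
        | count-cong (λ e → w≗w′ (e ↑ˡ t)) = refl

cocycleSize-congʳ : ∀ {r} m t (A : Mat r (m + t)) {x x′} → x ≗ x′ →
                    cocycleSize {m = m} {t} A x ≡ cocycleSize {m = m} {t} A x′
cocycleSize-congʳ m t A x≗x′ = cocycleSizeOf-cong m t (rowComb-congʳ A x≗x′)

asRow : ∀ {s} → Vector Bool s → Mat 1 s
asRow y _ = y

graftTop : ∀ {s m t} → Mat s m → Mat s t → Mat s (m + t)
graftTop {m = m} C D k j = [ C k , D k ] (splitAt m j)

graftTop-⊗ : ∀ {r s m t} (Y : Mat r s) (C : Mat s m) (D : Mat s t) i j →
             graftTop (Y ⊗ C) (Y ⊗ D) i j ≡ rowComb (graftTop C D) (Y i) j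
graftTop-⊗ {m = m} Y C D i j with splitAt m j
... | inj₁ e = refl
... | inj₂ τ = refl

module _ {n m t : ℕ} (G : Graph n m) (B : Mat n t) where

  graftBottom : Mat n (m + t)
  graftBottom v j = [ incidence G v , B v ] (splitAt m j)

  graftMatrix-↑ˡ : ∀ {s} (C : Mat s m) (D : Mat s t) k j →
                   graftMatrix G B C D (k ↑ˡ n) j ≡ graftTop C D k j
  graftMatrix-↑ˡ {s} C D k j rewrite splitAt-↑ˡ s k n with splitAt m j
  ... | inj₁ e = refl
  ... | inj₂ τ = refl

  graftMatrix-↑ʳ : ∀ {s} (C : Mat s m) (D : Mat s t) v j →
                   graftMatrix G B C D (s ↑ʳ v) j ≡ graftBottom v j
  graftMatrix-↑ʳ {s} C D v j rewrite splitAt-↑ʳ s n v with splitAt m j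
  ... | inj₁ e = refl
  ... | inj₂ τ = refl

  rowComb-graft-merge : ∀ {s} (C : Mat s m) (D : Mat s t) y {x} (x′ : Vector Bool (suc n)) →
    (∀ k → x (k ↑ˡ n) ≡ x′ zero ∧ y k) → (∀ v → x (s ↑ʳ v) ≡ x′ (suc v)) →
    rowComb (graftMatrix G B C D) x ≗ rowComb (graftMatrix G B (asRow y ⊗ C) (asRow y ⊗ D)) x′
  rowComb-graft-merge {s} C D y {x} x′ x↑ˡ x↑ʳ j =
    trans (rowComb-split s M x j) (cong₂ _xor_ signedRows vertexRows)
    where
    open ≡-Reasoning
    M  = graftMatrix G B C D
    M′ = graftMatrix G B (asRow y ⊗ C) (asRow y ⊗ D)

    signedRows : rowComb (λ k → M (k ↑ˡ n)) (λ k → x (k ↑ˡ n)) j ≡ x′ zero ∧ M′ zero j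
    signedRows = begin
      rowComb (λ k → M (k ↑ˡ n)) (λ k → x (k ↑ˡ n)) j
        ≡⟨ Σ₂-cong (λ k → cong₂ _∧_ (x↑ˡ k) (graftMatrix-↑ˡ C D k j)) ⟩
      rowComb (graftTop C D) (λ k → x′ zero ∧ y k) j
        ≡⟨ rowComb-scale (graftTop C D) (x′ zero) y j ⟩
      x′ zero ∧ rowComb (graftTop C D) y j
        ≡⟨ cong (x′ zero ∧_) (sym (trans (graftMatrix-↑ˡ (asRow y ⊗ C) (asRow y ⊗ D) zero j)
                                         (graftTop-⊗ (asRow y) C D zero j))) ⟩
      x′ zero ∧ M′ zero j ∎

    vertexRows : rowComb (λ v → M (s ↑ʳ v)) (λ v → x (s ↑ʳ v)) j
               ≡ rowComb (λ v → M′ (suc v)) (tail x′) j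
    vertexRows = Σ₂-cong (λ v → cong₂ _∧_ (x↑ʳ v)
      (trans (graftMatrix-↑ʳ C D v j) (sym (graftMatrix-↑ʳ (asRow y ⊗ C) (asRow y ⊗ D) v j))))

  module _ {s} (C : Mat s m) (D : Mat s t) where
    private
      M : Mat (s + n) (m + t)
      M = graftMatrix G B C D

      M′ : Vector Bool s → Mat (suc n) (m + t)
      M′ y = graftMatrix G B (asRow y ⊗ C) (asRow y ⊗ D)

    cocycleSize-graft-merge : ∀ y {x} (x′ : Vector Bool (suc n)) →
      (∀ k → x (k ↑ˡ n) ≡ x′ zero ∧ y k) → (∀ v → x (s ↑ʳ v) ≡ x′ (suc v)) →
      cocycleSize {m = m} {t} M x ≡ cocycleSize {m = m} {t} (M′ y) x′
    cocycleSize-graft-merge y x′ x↑ˡ x↑ʳ =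
      cocycleSizeOf-cong m t (rowComb-graft-merge C D y x′ x↑ˡ x↑ʳ)

    cogirth/T-≤-merged : ∀ y → cogirth/T m t M ≤∞ cogirth/T m t (M′ y)
    cogirth/T-≤-merged y = minList-glb _ (allVecs (suc n)) λ {x′} _ →
      let x = (λ k → x′ zero ∧ y k) ++ tail x′ in
      ≤∞-trans (minList-allVecs-≤ (cocycleSize {m = m} {t} M) (cocycleSize-congʳ m t M) x)
               (≤∞-reflexive (cocycleSize-graft-merge y x′ (lookup-++ˡ _ (tail x′))
                                                          (lookup-++ʳ (λ k → x′ zero ∧ y k) _)))

    merged-≤-cocycleSize : ∀ x → ∃ λ y → y ∈ allVecs s
                                          × cogirth/T m t (M′ y) ≤∞ cocycleSize {m = m} {t} M x
    merged-≤-cocycleSize x with allVecs-complete s (λ k → x (k ↑ˡ n))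
    ... | y , y∈ , y≗ = y , y∈ ,
      ≤∞-trans (minList-allVecs-≤ (cocycleSize {m = m} {t} (M′ y)) (cocycleSize-congʳ m t (M′ y)) x′)
               (≤∞-reflexive (sym (cocycleSize-graft-merge y x′ (λ k → sym (y≗ k)) (λ v → refl))))
      where
      x′ : Vector Bool (suc n)
      x′ = true ∷ᶠ (λ v → x (s ↑ʳ v))

lemma4p2 : {n m s t : ℕ} (G : Graph n m) (B : Mat n t) (C : Mat s m) (D : Mat s t) →
    cogirth/T m t (graftMatrix G B C D)
      ≡ minOverY (λ (y : Mat 1 s) → cogirth/T m t (graftMatrix G B (y ⊗ C) (y ⊗ D)))
lemma4p2 {n} {s = s} G B C D = ≤∞-antisym
  (minList-glb _ (allVecs s) λ {y} _ → cogirth/T-≤-merged G B C D y)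
  (minList-glb _ (allVecs (s + n)) λ {x} _ →
    let (y , y∈ , merged≤x) = merged-≤-cocycleSize G B C D x
    in ≤∞-trans (minList-≤ _ y∈) merged≤x)
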